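{- Let $p$ be a prime, let $G$ be a finite abelian $p$-group, and let $\boldsymbol{\alpha}=(\alpha_1,\ldots,\alpha_r)$ be a basis for a subgroup of $G$ with $n_i=\log_p|\alpha_i|$, $m_0=\min_i n_i$ and $m=\max_i n_i$. Let $\beta\in G$, let $(\mathbf{x},h)=\mathrm{DL}^*(\boldsymbol{\alpha},\beta)$, and let $\gamma=\beta\boldsymbol{\alpha}^{ -\mathbf{x}}$. Then: (i) if $|\beta|\le p^m$ then $|\gamma|=p^h$; (ii) if $|\beta|\le p^m$ and $|\gamma|\le p^{m_0}$ then $\gamma$ is independent of $\boldsymbol{\alpha}$, i.e. $(\alpha_1,\ldots,\alpha_r,\gamma)$ is a basis for $\langle\alpha_1,\ldots,\alpha_r,\gamma\rangle$.
   Context: A vector $\boldsymbol{\alpha}=(\alpha_1,\ldots,\alpha_r)$ of elements of a finite abelian group is a basis (for $\langle\boldsymbol{\alpha}\rangle$) if every element of $\langle\boldsymbol{\alpha}\rangle$ is uniquely $\boldsymbol{\alpha}^{\mathbf{x}}=\prod\alpha_i^{x_i}$ with $0\le x_i<|\alpha_i|$ (identity components allowed); this $\mathbf{x}$ is $\mathrm{DL}(\boldsymbol{\alpha},\cdot)$. For integers $0\le a<b$ put $q_i=p^{\,a+\max(0,n_i-b)}$, $\boldsymbol{\alpha}(a,b)=(\alpha_1^{q_1},\ldots,\alpha_r^{q_r})$, and $\mathrm{DL}_{\boldsymbol{\alpha}}(a,b,\delta)=\mathrm{DL}(\boldsymbol{\alpha}(a,b),\delta)$ for $\delta\in\langle\boldsymbol{\alpha}(a,b)\rangle$.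 For $\beta\in G$ and $0\le j<k$, $\mathrm{DL}^*_{\boldsymbol{\alpha}}(j,k,\beta)$ is the pair $(\mathbf{x},h)$ where $h\ge0$ is minimal such that $h<k-j$ and $\beta^{p^h}\in\langle\boldsymbol{\alpha}(j+h,k)\rangle$, and $\mathbf{x}=\mathrm{DL}_{\boldsymbol{\alpha}}(j+h,k,\beta^{p^h})$; if no such $h<k-j$ exists, then $h=k-j$ and $\mathbf{x}=0$. If $\langle\boldsymbol{\alpha}\rangle$ has exponent $p^m$, $\mathrm{DL}^*(\boldsymbol{\alpha},\beta)=\mathrm{DL}^*_{\boldsymbol{\alpha}}(0,m,\beta)$. -}

module Defs where

open import Level using (Level) renaming (_⊔_ to _⊔ℓ_)
open import Algebra.Bundles using (AbelianGroup)
open import Data.Nat using (ℕ; zero; suc; _+_; _∸_; _^_; _<_; _≤_) renaming (_⊔_ to max; _⊓_ to min)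
open import Data.Fin using (Fin; zero; suc)
open import Data.Product using (Σ; ∃; _×_; _,_)
open import Data.Sum using (_⊎_)
open import Relation.Nullary using (¬_)
open import Relation.Binary.PropositionalEquality using (_≡_)

-- maximum / minimum of a finite family of naturals
-- (max of the empty family is 0; min of the empty family is taken to be 0)
maxF : ∀ {r} → (Fin r → ℕ) → ℕ
maxF {zero} f = 0
maxF {suc r} f = max (f zero) (maxF (λ i → f (suc i)))

minF : ∀ {r} → (Fin r → ℕ) → ℕ
minF {zero} f = 0
minF {suc zero} f = f zero
minF {suc (suc r)} f = min (f zero) (minF (λ i → f (suc i)))

snoc : ∀ {a} {A : Set a} {r} → (Fin r → A) → A → Fin (suc r) → A
snoc {r = zero} α γ zero = γ
snoc {r = suc r} α γ zero = α zero
snoc {r = suc r} α γ (suc i) = snoc (λ j → α (suc j)) γ i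

module _ {c ℓ} (G : AbelianGroup c ℓ) where
  open AbelianGroup G renaming (Carrier to A)

  pow : A → ℕ → A
  pow g zero = ε
  pow g (suc k) = g ∙ pow g k

  mexp : ∀ {r} → (Fin r → A) → (Fin r → ℕ) → A
  mexp {zero} α x = ε
  mexp {suc r} α x = pow (α zero) (x zero) ∙ mexp (λ i → α (suc i)) (λ i → x (suc i))

  Finite : Set (c ⊔ℓ ℓ)
  Finite = Σ ℕ λ N → Σ (Fin N → A) λ e → ∀ g → ∃ λ i → e i ≈ g

  HasOrder : A → ℕ → Set ℓ
  HasOrder g k = 0 < k × pow g k ≈ ε × (∀ j → 0 < j → j < k → ¬ (pow g j ≈ ε))

  _<ord_ : ℕ → A → Set ℓ
  x <ord g = ∃ λ k → HasOrder g k × x < k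

  OrdLe : A → ℕ → Set ℓ
  OrdLe g k = ∃ λ o → HasOrder g o × o ≤ k

  IsPGroup : ℕ → Set (c ⊔ℓ ℓ)
  IsPGroup p = ∀ g → ∃ λ n → HasOrder g (p ^ n)

  -- δ ∈ ⟨α⟩  (G finite, so non-negative exponents suffice)
  InSpan : ∀ {r} → (Fin r → A) → A → Set ℓ
  InSpan {r} α δ = ∃ λ (y : Fin r → ℕ) → mexp α y ≈ δ

  IsBasis : ∀ {r} → (Fin r → A) → Set ℓ
  IsBasis {r} α =
    (∀ (y : Fin r → ℕ) → ∃ λ (x : Fin r → ℕ) → (∀ i → x i <ord α i) × mexp α x ≈ mexp α y)
    × (∀ (x y : Fin r → ℕ) → (∀ i → x i <ord α i) → (∀ i → y i <ord α i)
         → mexp α x ≈ mexp α y → ∀ i → x i ≡ y i)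

  IsDL : ∀ {r} → (Fin r → A) → A → (Fin r → ℕ) → Set ℓ
  IsDL α δ x = (∀ i → x i <ord α i) × mexp α x ≈ δ

  module _ (p : ℕ) {r : ℕ} (α : Fin r → A) (n : Fin r → ℕ) where

    αab : ℕ → ℕ → Fin r → A
    αab a b i = pow (α i) (p ^ (a + (n i ∸ b)))

    IsDLStar : ℕ → ℕ → A → (Fin r → ℕ) → ℕ → Set ℓ
    IsDLStar j k β x h =
        ( h < k ∸ j
        × (∀ h' → h' < h → ¬ InSpan (αab (j + h') k) (pow β (p ^ h')))
        × InSpan (αab (j + h) k) (pow β (p ^ h))
        × IsDL (αab (j + h) k) (pow β (p ^ h)) x )
      ⊎ ( h ≡ k ∸ j
        × (∀ h' → h' < k ∸ j → ¬ InSpan (αab (j + h') k) (pow β (p ^ h')))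
        × (∀ i → x i ≡ 0) )

{-# OPTIONS --safe #-}
-- Minimality of h in DL* says that β^(p^h′) ∉ ⟨α^(p^h′)⟩ for h′ < h;
-- as β^(p^h′) = γ^(p^h′) (α^x)^(p^h′), this forces γ^(p^h′) ≠ 1, while γ^(p^h) = 1 by the
-- choice of x (or, when h = m, because |β| ≤ p^m).  Hence |γ| = p^h.
-- For independence it suffices that no γ^d with 0 < d < p^h lies in ⟨α⟩.  Writing d = p^s u
-- with p ∤ u and inverting u modulo p^h, γ^(p^s) = α^w would follow for some s < h.  Then
-- α^(w p^(h-s)) = 1, and since every |αᵢ| = p^(nᵢ) ≥ |γ| = p^h, each wᵢ is divisible by p^s.
-- So γ^(p^s), and with it β^(p^s), lies in ⟨α^(p^s)⟩, contradicting the minimality of h.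

module Submission where

open import Defs
open import Algebra.Bundles using (AbelianGroup)
open import Data.Nat
  using (ℕ; zero; suc; _+_; _*_; _∸_; _^_; _<_; _≤_; z≤n; z<s; NonZero; >-nonZero; nonTrivial⇒n>1; _%_; _/_)
open import Data.Nat.Properties
open import Data.Nat.Divisibility
open import Data.Nat.DivMod using (m≡m%n+[m/n]*n; m%n<n)
open import Data.Nat.Coprimality using (Coprime; coprime-Bézout; coprime-divisor)
open import Data.Nat.GCD using (module Bézout)
open import Data.Nat.Primality using (Prime; prime⇒irreducible; prime⇒nonTrivial)
open import Data.Nat.Induction using (<-wellFounded)
open import Data.Nat.Tactic.RingSolver using (solve)
open import Data.List using ([]; _∷_)
open import Induction.WellFounded using (Acc; acc)
open import Data.Fin using (Fin; zero; suc; inject₁; fromℕ)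
open import Data.Product using (∃; ∃₂; _×_; _,_; proj₁; proj₂; map)
open import Data.Sum using (inj₁; inj₂)
open import Function using (_∘_; it)
open import Relation.Nullary using (¬_; yes; no; contradiction)
open import Relation.Binary.Definitions using (tri<; tri≈; tri>)
open import Relation.Binary.PropositionalEquality as ≡ using (_≡_; cong)

^-monoʳ-∣ : ∀ p {a b} → a ≤ b → p ^ a ∣ p ^ b
^-monoʳ-∣ p {a} {b} a≤b = divides (p ^ (b ∸ a)) (begin
  p ^ b                 ≡⟨ cong (p ^_) (m+[n∸m]≡n a≤b) ⟨
  p ^ (a + (b ∸ a))     ≡⟨ ^-distribˡ-+-* p a (b ∸ a) ⟩
  p ^ a * p ^ (b ∸ a)   ≡⟨ *-comm (p ^ a) _ ⟩
  p ^ (b ∸ a) * p ^ a   ∎)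
  where open ≡.≡-Reasoning

module _ {p : ℕ} (1<p : 1 < p) where
  private instance
    p≢0 : NonZero p
    p≢0 = >-nonZero (<-trans z<s 1<p)

  ^-cancelˡ-≤ : ∀ {a b} → p ^ a ≤ p ^ b → a ≤ b
  ^-cancelˡ-≤ le = ≮⇒≥ (λ b<a → <⇒≱ (^-monoʳ-< p 1<p b<a) le)

  ^-cancelˡ-< : ∀ {a b} → p ^ a < p ^ b → a < b
  ^-cancelˡ-< lt = ≰⇒> (λ b≤a → <⇒≱ lt (^-monoʳ-≤ p b≤a))

  ^-cancelˡ-∣ : ∀ {a b} → p ^ a ∣ p ^ b → a ≤ b
  ^-cancelˡ-∣ {b = b} d = ^-cancelˡ-≤ (∣⇒≤ {{m^n≢0 p b}} d)

  p-adic-split : ∀ d → .{{NonZero d}} → ∃₂ λ s u → d ≡ p ^ s * u × ¬ p ∣ u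
  p-adic-split d = split d (<-wellFounded d)
    where
    split : ∀ d → Acc _<_ d → .{{NonZero d}} → ∃₂ λ s u → d ≡ p ^ s * u × ¬ p ∣ u
    split d _ with p ∣? d
    split d _ | no p∤d = 0 , d , ≡.sym (+-identityʳ d) , p∤d
    split _ (acc smaller) | yes (divides q ≡.refl) =
      let instance _ = m*n≢0⇒m≢0 q
          s , u , q≡ , p∤u = split q (smaller (m<m*n q p 1<p))
      in suc s , u , ≡.trans (*-comm q p) (≡.trans (cong (p *_) q≡) (≡.sym (*-assoc p (p ^ s) u)))
       , p∤u

  ^-∣-cancelʳ : ∀ {s t n w} → s + t ≤ n → p ^ n ∣ w * p ^ t → p ^ s ∣ w
  ^-∣-cancelʳ {s} {t} {n} {w} s+t≤n pⁿ∣w*pᵗ = *-cancelʳ-∣ (p ^ t) {{m^n≢0 p t}}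
    (≡.subst (_∣ w * p ^ t) (^-distribˡ-+-* p s t) (∣-trans (^-monoʳ-∣ p s+t≤n) pⁿ∣w*pᵗ))

prime⇒1<p : ∀ {p} → Prime p → 1 < p
prime⇒1<p {p} pr = nonTrivial⇒n>1 p {{prime⇒nonTrivial pr}}

¬∣⇒coprime-^ : ∀ {p u} → Prime p → ¬ p ∣ u → ∀ h → Coprime u (p ^ h)
¬∣⇒coprime-^ pr p∤u zero (_ , d∣1) = ∣1⇒≡1 d∣1
¬∣⇒coprime-^ {p} pr p∤u (suc h) {d} (d∣u , d∣p*pʰ) =
  ¬∣⇒coprime-^ pr p∤u h (d∣u , coprime-divisor d⊥p d∣p*pʰ)
  where
  d⊥p : Coprime d p
  d⊥p (e∣d , e∣p) with prime⇒irreducible pr e∣p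
  ... | inj₁ e≡1 = e≡1
  ... | inj₂ ≡.refl = contradiction (∣-trans e∣d d∣u) p∤u

coprime⇒invertible : ∀ {u P} → Coprime u P → 1 < P → ∃₂ λ a B → a * u ≡ 1 + B * P
coprime⇒invertible {u} {P} u⊥P 1<P with coprime-Bézout u⊥P
... | Bézout.+- a b eq = a , b , ≡.sym eq
... | Bézout.-+ a b eq with a * u in au≡
... | zero = contradiction (∣1⇒≡1 (divides b eq)) (>⇒≢ 1<P)
... | suc c = a * suc c , c * b , (begin
  -- here a·u ≡ -1 (mod P), so a·u·(a·u) ≡ 1 (mod P)
  a * suc c * u         ≡⟨ solve (a ∷ c ∷ u ∷ []) ⟩
  suc c * (a * u)       ≡⟨ cong (suc c *_) au≡ ⟩
  suc c * suc c         ≡⟨ solve (c ∷ []) ⟩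
  1 + c * (1 + suc c)   ≡⟨ cong (λ z → 1 + c * z) eq ⟩
  1 + c * (b * P)       ≡⟨ cong suc (*-assoc c b P) ⟨
  1 + c * b * P         ∎)
  where open ≡.≡-Reasoning

p-adic-inverse : ∀ {p h d} → Prime p → 0 < d → d < p ^ h
  → ∃₂ λ s a → s < h × ∃ λ B → d * a ≡ p ^ s + p ^ h * (B * p ^ s)
p-adic-inverse {p} {h} {d} pr 0<d d<pʰ =
  let s , u , d≡pˢu , p∤u = p-adic-split 1<p d
      instance _ = m*n≢0⇒n≢0 (p ^ s) {{≡.subst NonZero d≡pˢu it}}
      pˢ≤d = ≡.subst (p ^ s ≤_) (≡.sym d≡pˢu) (m≤m*n (p ^ s) u)
      s<h = ^-cancelˡ-< 1<p (≤-<-trans pˢ≤d d<pʰ)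
      a , B , au≡ = coprime⇒invertible (¬∣⇒coprime-^ pr p∤u h)
        (^-monoʳ-< p 1<p {0} (≤-<-trans z≤n s<h))
  in s , a , s<h , B , ≡.trans (cong (_* a) d≡pˢu) (rearrange u a B (p ^ s) (p ^ h) au≡)
  where
  1<p = prime⇒1<p pr
  instance _ = >-nonZero 0<d
  rearrange : ∀ u a B x P → a * u ≡ 1 + B * P → x * u * a ≡ x + P * (B * x)
  rearrange u a B x P au≡ = begin
    x * u * a         ≡⟨ solve (x ∷ u ∷ a ∷ []) ⟩
    x * (a * u)       ≡⟨ cong (x *_) au≡ ⟩
    x * (1 + B * P)   ≡⟨ solve (x ∷ P ∷ B ∷ []) ⟩
    x + P * (B * x)   ∎
    where open ≡.≡-Reasoning

maxF-upper : ∀ {r} (f : Fin r → ℕ) i → f i ≤ maxF f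
maxF-upper {suc r} f zero = m≤m⊔n (f zero) _
maxF-upper {suc r} f (suc i) = ≤-trans (maxF-upper (f ∘ suc) i) (m≤n⊔m (f zero) _)

minF-lower : ∀ {r} (f : Fin r → ℕ) i → minF f ≤ f i
minF-lower {suc zero} f zero = ≤-refl
minF-lower {suc (suc r)} f zero = m⊓n≤m (f zero) _
minF-lower {suc (suc r)} f (suc i) = ≤-trans (m⊓n≤n (f zero) _) (minF-lower (f ∘ suc) i)

snoc-inject₁ : ∀ {a} {B : Set a} {r} (f : Fin r → B) b i → snoc f b (inject₁ i) ≡ f i
snoc-inject₁ {r = suc r} f b zero = ≡.refl
snoc-inject₁ {r = suc r} f b (suc i) = snoc-inject₁ (f ∘ suc) b i

snoc-last : ∀ {a} {B : Set a} {r} (f : Fin r → B) b → snoc f b (fromℕ r) ≡ b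
snoc-last {r = zero} f b = ≡.refl
snoc-last {r = suc r} f b = snoc-last (f ∘ suc) b

snoc-All : ∀ {a p} {B : Set a} {r} (P : B → Set p) {f : Fin r → B} {b}
  → (∀ i → P (f i)) → P b → ∀ i → P (snoc f b i)
snoc-All {r = zero} P Pf Pb zero = Pb
snoc-All {r = suc r} P Pf Pb zero = Pf zero
snoc-All {r = suc r} P Pf Pb (suc i) = snoc-All P (Pf ∘ suc) Pb i

inject₁-fromℕ-elim : ∀ {p} {r} (P : Fin (suc r) → Set p)
  → (∀ i → P (inject₁ i)) → P (fromℕ r) → ∀ i → P i
inject₁-fromℕ-elim {r = zero} P Pinj Plast zero = Plast
inject₁-fromℕ-elim {r = suc r} P Pinj Plast zero = Pinj zero
inject₁-fromℕ-elim {r = suc r} P Pinj Plast (suc i) =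
  inject₁-fromℕ-elim (P ∘ suc) (Pinj ∘ suc) Plast i

module _ {c ℓ} (G : AbelianGroup c ℓ) where
  open AbelianGroup G renaming (Carrier to A)
  open import Relation.Binary.Reasoning.Setoid setoid
  open import Algebra.Properties.Group group using (inverseʳ-unique; ∙-cancelʳ; \\-leftDividesʳ)
  open import Algebra.Properties.CommutativeSemigroup commutativeSemigroup using (interchange)
  open import Algebra.Properties.CommutativeMonoid.Mult commutativeMonoid
    using (×-congʳ; ×-homo-+; ×-assocˡ; ×-distrib-+) renaming (_×_ to _·_)

  pow≡· : ∀ g k → pow G g k ≡ k · g
  pow≡· g zero = ≡.refl
  pow≡· g (suc k) = cong (g ∙_) (pow≡· g k)

  pow-congˡ : ∀ {g h} k → g ≈ h → pow G g k ≈ pow G h k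
  pow-congˡ {g} {h} k g≈h rewrite pow≡· g k | pow≡· h k = ×-congʳ k g≈h

  pow-+ : ∀ g a b → pow G g (a + b) ≈ pow G g a ∙ pow G g b
  pow-+ g a b rewrite pow≡· g (a + b) | pow≡· g a | pow≡· g b = ×-homo-+ g a b

  pow-* : ∀ g a b → pow G g (a * b) ≈ pow G (pow G g a) b
  pow-* g a b rewrite pow≡· (pow G g a) b | pow≡· g (a * b) | pow≡· g a =
    trans (reflexive (cong (_· g) (*-comm a b))) (sym (×-assocˡ g b a))

  pow-∙ : ∀ g h k → pow G (g ∙ h) k ≈ pow G g k ∙ pow G h k
  pow-∙ g h k rewrite pow≡· (g ∙ h) k | pow≡· g k | pow≡· h k = ×-distrib-+ g h k

  pow-ε : ∀ k → pow G ε k ≈ ε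
  pow-ε zero = refl
  pow-ε (suc k) = trans (identityˡ _) (pow-ε k)

  mexp-cong : ∀ {r} (α : Fin r → A) {x y : Fin r → ℕ}
    → (∀ i → pow G (α i) (x i) ≈ pow G (α i) (y i)) → mexp G α x ≈ mexp G α y
  mexp-cong {zero} α _ = refl
  mexp-cong {suc r} α e = ∙-cong (e zero) (mexp-cong (α ∘ suc) (e ∘ suc))

  mexp-congʳ : ∀ {r} (α : Fin r → A) {x y : Fin r → ℕ}
    → (∀ i → x i ≡ y i) → mexp G α x ≈ mexp G α y
  mexp-congʳ α x≗y = mexp-cong α (λ i → reflexive (cong (pow G (α i)) (x≗y i)))

  mexp-zero : ∀ {r} (α : Fin r → A) → mexp G α (λ _ → 0) ≈ ε
  mexp-zero {zero} α = refl
  mexp-zero {suc r} α = trans (identityˡ _) (mexp-zero (α ∘ suc))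

  mexp-+ : ∀ {r} (α : Fin r → A) (x y : Fin r → ℕ)
    → mexp G α (λ i → x i + y i) ≈ mexp G α x ∙ mexp G α y
  mexp-+ {zero} α x y = sym (identityˡ ε)
  mexp-+ {suc r} α x y = trans
    (∙-cong (pow-+ (α zero) (x zero) (y zero)) (mexp-+ (α ∘ suc) (x ∘ suc) (y ∘ suc)))
    (interchange _ _ _ _)

  mexp-pow : ∀ {r} (α : Fin r → A) (x : Fin r → ℕ) k
    → pow G (mexp G α x) k ≈ mexp G α (λ i → x i * k)
  mexp-pow {zero} α x k = pow-ε k
  mexp-pow {suc r} α x k = trans (pow-∙ _ _ k)
    (∙-cong (sym (pow-* (α zero) (x zero) k)) (mexp-pow (α ∘ suc) (x ∘ suc) k))

  mexp-powers : ∀ {r} (α : Fin r → A) (q w : Fin r → ℕ)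
    → mexp G (λ i → pow G (α i) (q i)) w ≈ mexp G α (λ i → q i * w i)
  mexp-powers {zero} α q w = refl
  mexp-powers {suc r} α q w =
    ∙-cong (sym (pow-* (α zero) (q zero) (w zero))) (mexp-powers (α ∘ suc) (q ∘ suc) (w ∘ suc))

  mexp-snoc : ∀ {r} (α : Fin r → A) γ (x : Fin (suc r) → ℕ)
    → mexp G (snoc α γ) x ≈ mexp G α (x ∘ inject₁) ∙ pow G γ (x (fromℕ r))
  mexp-snoc {zero} α γ x = trans (identityʳ _) (sym (identityˡ _))
  mexp-snoc {suc r} α γ x = trans (∙-congˡ (mexp-snoc (α ∘ suc) γ (x ∘ suc))) (sym (assoc _ _ _))

  order-unique : ∀ {g a b} → HasOrder G g a → HasOrder G g b → a ≡ b
  order-unique (0<a , gᵃ≈ε , a-minimal) (0<b , gᵇ≈ε , b-minimal) with <-cmp _ _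
  ... | tri< a<b _ _ = contradiction gᵃ≈ε (b-minimal _ 0<a a<b)
  ... | tri≈ _ a≡b _ = a≡b
  ... | tri> _ _ b<a = contradiction gᵇ≈ε (a-minimal _ 0<b b<a)

  pow-*≈ε : ∀ g m k → pow G g m ≈ ε → pow G g (m * k) ≈ ε
  pow-*≈ε g m k gᵐ≈ε = begin
    pow G g (m * k)          ≈⟨ pow-* g m k ⟩
    pow G (pow G g m) k      ≈⟨ pow-congˡ k gᵐ≈ε ⟩
    pow G ε k                ≈⟨ pow-ε k ⟩
    ε                        ∎

  order∣⇒pow≈ε : ∀ {g o k} → HasOrder G g o → o ∣ k → pow G g k ≈ ε
  order∣⇒pow≈ε {g} {o} (_ , gᵒ≈ε , _) (divides q ≡.refl) =
    trans (reflexive (cong (pow G g) (*-comm q o))) (pow-*≈ε g o q gᵒ≈ε)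

  pow-% : ∀ {g o} → HasOrder G g o → ∀ k .{{_ : NonZero o}} → pow G g k ≈ pow G g (k % o)
  pow-% {g} {o} ho k = begin
    pow G g k                               ≡⟨ cong (pow G g) (m≡m%n+[m/n]*n k o) ⟩
    pow G g (k % o + k / o * o)             ≈⟨ pow-+ g (k % o) (k / o * o) ⟩
    pow G g (k % o) ∙ pow G g (k / o * o)   ≈⟨ ∙-congˡ (order∣⇒pow≈ε ho (n∣m*n (k / o))) ⟩
    pow G g (k % o) ∙ ε                     ≈⟨ identityʳ _ ⟩
    pow G g (k % o)                         ∎

  pow≈ε⇒order∣ : ∀ {g o k} → HasOrder G g o → pow G g k ≈ ε → o ∣ k
  pow≈ε⇒order∣ {g} {o} {k} ho@(0<o , _ , o-minimal) gᵏ≈ε =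
    m%n≡0⇒n∣m k o (n≤0⇒n≡0 (≮⇒≥ k%o≮0))
    where
    instance _ = >-nonZero 0<o
    k%o≮0 : ¬ 0 < k % o
    k%o≮0 0<k%o = o-minimal _ 0<k%o (m%n<n k o) (trans (sym (pow-% ho k)) gᵏ≈ε)

  pow-reduce : ∀ {g} → ∃ (HasOrder G g)
    → ∀ k → ∃ λ k′ → _<ord_ G k′ g × pow G g k′ ≈ pow G g k
  pow-reduce (o , ho) k = k % o , (o , ho , m%n<n k o) , sym (pow-% ho k)
    where instance _ = >-nonZero (proj₁ ho)

  reduced-exponents : ∀ {r} (α : Fin r → A) → (∀ i → ∃ (HasOrder G (α i)))
    → ∀ y → ∃ (IsDL G α (mexp G α y))
  reduced-exponents α orders y =
    proj₁ ∘ reduce , proj₁ ∘ proj₂ ∘ reduce , mexp-cong α (proj₂ ∘ proj₂ ∘ reduce)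
    where
    reduce : ∀ i → ∃ λ k → _<ord_ G k (α i) × pow G (α i) k ≈ pow G (α i) (y i)
    reduce i = pow-reduce (orders i) (y i)

  InSpan-∙ : ∀ {r} {α : Fin r → A} {g h} → InSpan G α g → InSpan G α h → InSpan G α (g ∙ h)
  InSpan-∙ {α = α} (x , αˣ≈g) (y , αʸ≈h) =
    (λ i → x i + y i) , trans (mexp-+ α x y) (∙-cong αˣ≈g αʸ≈h)

  InSpan-⁻¹ : ∀ {r} {α : Fin r → A} {g} → (∀ i → ∃ (HasOrder G (α i)))
    → InSpan G α g → InSpan G α (g ⁻¹)
  InSpan-⁻¹ {r} {α} {g} orders (x , αˣ≈g) = y , inverseʳ-unique g (mexp G α y) (begin
    g ∙ mexp G α y               ≈⟨ ∙-congʳ αˣ≈g ⟨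
    mexp G α x ∙ mexp G α y      ≈⟨ mexp-+ α x y ⟨
    mexp G α (λ i → x i + y i)   ≈⟨ mexp-cong α (λ i → order∣⇒pow≈ε (proj₂ (orders i)) (o∣x+y i)) ⟩
    mexp G α (λ _ → 0)           ≈⟨ mexp-zero α ⟩
    ε                            ∎)
    where
    o : Fin r → ℕ
    o i = proj₁ (orders i)
    y : Fin r → ℕ
    y i = (o i ∸ 1) * x i
    o∣x+y : ∀ i → o i ∣ x i + y i
    o∣x+y i = divides (x i) (≡.trans (cong (_* x i) (m+[n∸m]≡n (proj₁ (proj₂ (orders i)))))
                                     (*-comm (o i) (x i)))

  basis⇒orders : ∀ {r} {α : Fin r → A} → IsBasis G α → ∀ i → ∃ (HasOrder G (α i))
  basis⇒orders (reduce , _) i =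
    let o , ho , _ = proj₁ (proj₂ (reduce (λ _ → 0))) i in o , ho

  basis-relation : ∀ {r} {α : Fin r → A} {w} → IsBasis G α → mexp G α w ≈ ε
    → ∀ i → pow G (α i) (w i) ≈ ε
  basis-relation {r} {α} {w} bas@(_ , unique) αʷ≈ε i = begin
    pow G (α i) (w i)     ≈⟨ proj₂ (proj₂ (reduce i)) ⟨
    pow G (α i) (x i)     ≡⟨ cong (pow G (α i)) (x≡0 i) ⟩
    ε                     ∎
    where
    reduce : ∀ i → ∃ λ k → _<ord_ G k (α i) × pow G (α i) k ≈ pow G (α i) (w i)
    reduce i = pow-reduce (basis⇒orders bas i) (w i)
    x : Fin r → ℕ
    x = proj₁ ∘ reduce
    x≡0 : ∀ i → x i ≡ 0
    x≡0 = unique x (λ _ → 0) (proj₁ ∘ proj₂ ∘ reduce)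
      (λ i → let o , ho = basis⇒orders bas i in o , ho , proj₁ ho)
      (trans (mexp-cong α (proj₂ ∘ proj₂ ∘ reduce)) (trans αʷ≈ε (sym (mexp-zero α))))

  snoc-basis : ∀ {r} {α : Fin r → A} {γ o} → IsBasis G α → HasOrder G γ o
    → (∀ d → 0 < d → d < o → ¬ InSpan G α (pow G γ d)) → IsBasis G (snoc α γ)
  snoc-basis {r} {α} {γ} {o} bas@(_ , unique) hγ powers-outside =
    reduced-exponents (snoc α γ) (snoc-All (∃ ∘ HasOrder G) (basis⇒orders bas) (o , hγ))
    , unique-snoc
    where
    cancel : ∀ {g h} a d → g ∙ pow G γ a ≈ h ∙ pow G γ (a + d) → g ≈ h ∙ pow G γ d
    cancel {g} {h} a d eq = ∙-cancelʳ (pow G γ a) _ _ (begin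
      g ∙ pow G γ a                 ≈⟨ eq ⟩
      h ∙ pow G γ (a + d)           ≈⟨ ∙-congˡ (pow-+ γ a d) ⟩
      h ∙ (pow G γ a ∙ pow G γ d)   ≈⟨ ∙-congˡ (comm _ _) ⟩
      h ∙ (pow G γ d ∙ pow G γ a)   ≈⟨ assoc _ _ _ ⟨
      h ∙ pow G γ d ∙ pow G γ a     ∎)

    unique-≤ : ∀ x y a b → (∀ i → _<ord_ G (x i) (α i)) → (∀ i → _<ord_ G (y i) (α i))
      → b < o → a ≤ b → mexp G α x ∙ pow G γ a ≈ mexp G α y ∙ pow G γ b
      → a ≡ b × (∀ i → x i ≡ y i)
    unique-≤ x y a b x< y< b<o a≤b eq with m≤n⇒∃[o]m+o≡n a≤b
    ... | zero , ≡.refl = ≡.sym (+-identityʳ a) , unique x y x< y< (trans (cancel a 0 eq) (identityʳ _))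
    ... | suc d , ≡.refl =
      contradiction γᵈ∈⟨α⟩ (powers-outside (suc d) z<s (≤-<-trans (m≤n+m (suc d) a) b<o))
      where
      γᵈ∈⟨α⟩ : InSpan G α (pow G γ (suc d))
      γᵈ∈⟨α⟩ =
        let w , αʷ≈ = InSpan-∙ (InSpan-⁻¹ (basis⇒orders bas) (y , refl)) (x , refl)
        in w , trans αʷ≈ (trans (∙-congˡ (cancel a (suc d) eq)) (\\-leftDividesʳ _ _))

    unique-snoc : ∀ x y
      → (∀ i → _<ord_ G (x i) (snoc α γ i)) → (∀ i → _<ord_ G (y i) (snoc α γ i))
      → mexp G (snoc α γ) x ≈ mexp G (snoc α γ) y → ∀ i → x i ≡ y i
    unique-snoc x y x< y< eq = inject₁-fromℕ-elim (λ i → x i ≡ y i) (proj₂ split) (proj₁ split)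
      where
      bounds-α : ∀ {z : Fin (suc r) → ℕ} → (∀ i → _<ord_ G (z i) (snoc α γ i))
        → ∀ i → _<ord_ G (z (inject₁ i)) (α i)
      bounds-α z< i = ≡.subst (_<ord_ G _) (snoc-inject₁ α γ i) (z< (inject₁ i))
      bound-γ : ∀ {z : Fin (suc r) → ℕ} → (∀ i → _<ord_ G (z i) (snoc α γ i))
        → z (fromℕ r) < o
      bound-γ z< with ≡.subst (_<ord_ G _) (snoc-last α γ) (z< (fromℕ r))
      ... | _ , hγ′ , lt = ≡.subst (_ <_) (order-unique hγ′ hγ) lt
      eq′ : mexp G α (x ∘ inject₁) ∙ pow G γ (x (fromℕ r))
          ≈ mexp G α (y ∘ inject₁) ∙ pow G γ (y (fromℕ r))
      eq′ = trans (sym (mexp-snoc α γ x)) (trans eq (mexp-snoc α γ y))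
      split : x (fromℕ r) ≡ y (fromℕ r) × (∀ i → x (inject₁ i) ≡ y (inject₁ i))
      split with ≤-total (x (fromℕ r)) (y (fromℕ r))
      ... | inj₁ a≤b =
        unique-≤ (x ∘ inject₁) (y ∘ inject₁) _ _
          (bounds-α x<) (bounds-α y<) (bound-γ y<) a≤b eq′
      ... | inj₂ b≤a = map ≡.sym (≡.sym ∘_)
        (unique-≤ (y ∘ inject₁) (x ∘ inject₁) _ _
          (bounds-α y<) (bounds-α x<) (bound-γ x<) b≤a (sym eq′))

  p-power∈⟨pow⟩ : ∀ {p g h d} → Prime p → pow G g (p ^ h) ≈ ε → 0 < d → d < p ^ h
    → ∃₂ λ s a → s < h × pow G g (p ^ s) ≈ pow G (pow G g d) a
  p-power∈⟨pow⟩ {p} {g} {h} {d} pr gᵖʰ≈ε 0<d d<pʰ =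
    let s , a , s<h , B , d*a≡ = p-adic-inverse pr 0<d d<pʰ in
    s , a , s<h , (begin
      pow G g (p ^ s)                                   ≈⟨ identityʳ _ ⟨
      pow G g (p ^ s) ∙ ε                               ≈⟨ ∙-congˡ (pow-*≈ε g (p ^ h) (B * p ^ s) gᵖʰ≈ε) ⟨
      pow G g (p ^ s) ∙ pow G g (p ^ h * (B * p ^ s))   ≈⟨ pow-+ g (p ^ s) (p ^ h * (B * p ^ s)) ⟨
      pow G g (p ^ s + p ^ h * (B * p ^ s))             ≡⟨ cong (pow G g) d*a≡ ⟨
      pow G g (d * a)                                   ≈⟨ pow-* g d a ⟩
      pow G (pow G g d) a                               ∎)

  basis-pow≈ε⇒∣ : ∀ {p r} {α : Fin r → A} {n : Fin r → ℕ} {w s t} → 1 < p → IsBasis G α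
    → (∀ i → HasOrder G (α i) (p ^ n i)) → pow G (mexp G α w) (p ^ t) ≈ ε
    → (∀ i → s + t ≤ n i) → ∀ i → p ^ s ∣ w i
  basis-pow≈ε⇒∣ {p} {α = α} {w = w} {s} {t} 1<p bas hα αʷᵖᵗ≈ε s+t≤n i =
    ^-∣-cancelʳ 1<p {s} {t} (s+t≤n i)
      (pow≈ε⇒order∣ (hα i) (basis-relation bas (trans (sym (mexp-pow α w (p ^ t))) αʷᵖᵗ≈ε) i))

  module _ {p : ℕ} (1<p : 1 < p) where

    pow-p^≈ε⇒≤ : ∀ {g e k} → HasOrder G g (p ^ e) → pow G g (p ^ k) ≈ ε → e ≤ k
    pow-p^≈ε⇒≤ {e = e} {k} he gᵖᵏ≈ε = ^-cancelˡ-∣ 1<p {e} {k} (pow≈ε⇒order∣ he gᵖᵏ≈ε)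

    OrdLe-p^⇒≤ : ∀ {g e k} → HasOrder G g (p ^ e) → OrdLe G g (p ^ k) → e ≤ k
    OrdLe-p^⇒≤ {e = e} {k} he (o , ho , o≤pᵏ) =
      ^-cancelˡ-≤ 1<p {e} {k} (≡.subst (_≤ _) (order-unique ho he) o≤pᵏ)

    module _ (pgroup : IsPGroup G p) where

      OrdLe⇒pow≈ε : ∀ {g k} → OrdLe G g (p ^ k) → pow G g (p ^ k) ≈ ε
      OrdLe⇒pow≈ε {g} {k} ord≤ =
        let e , he = pgroup g in order∣⇒pow≈ε he (^-monoʳ-∣ p (OrdLe-p^⇒≤ {e = e} {k} he ord≤))

      order-p^ : ∀ {g h} → pow G g (p ^ h) ≈ ε → (∀ h′ → h′ < h → ¬ pow G g (p ^ h′) ≈ ε)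
        → HasOrder G g (p ^ h)
      order-p^ {g} {h} gᵖʰ≈ε alive-below with pgroup g
      ... | e , he = ≡.subst (HasOrder G g ∘ (p ^_))
        (≤∧≮⇒≡ (pow-p^≈ε⇒≤ {e = e} {h} he gᵖʰ≈ε) (λ e<h → alive-below e e<h (proj₁ (proj₂ he))))
        he

module Residue {c ℓ} (G : AbelianGroup c ℓ) {p : ℕ} (pr : Prime p) (pgroup : IsPGroup G p)
  {r : ℕ} {α : Fin r → AbelianGroup.Carrier G} {n : Fin r → ℕ}
  (hα : ∀ i → HasOrder G (α i) (p ^ n i)) (basis : IsBasis G α)
  (β : AbelianGroup.Carrier G) (x : Fin r → ℕ) where

  open AbelianGroup G renaming (Carrier to A)
  open import Relation.Binary.Reasoning.Setoid setoid
  open import Algebra.Properties.Group group using (∙-cancelʳ; //-rightDividesˡ; ε⁻¹≈ε)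

  private
    1<p : 1 < p
    1<p = prime⇒1<p pr
    m : ℕ
    m = maxF n
    M : A
    M = mexp G α x

  γ : A
  γ = β ∙ M ⁻¹

  NotInSpanBelow : ℕ → Set ℓ
  NotInSpanBelow h = ∀ h′ → h′ < h → ¬ InSpan G (αab G p α n h′ m) (pow G β (p ^ h′))

  mexp-αab : ∀ s w → mexp G (αab G p α n s m) w ≈ mexp G α (λ i → p ^ s * w i)
  mexp-αab s w = trans (mexp-powers G α (λ i → p ^ (s + (n i ∸ m))) w) (mexp-congʳ G α λ i →
    cong (λ e → p ^ e * w i) (≡.trans (cong (s +_) (m≤n⇒m∸n≡0 (maxF-upper n i))) (+-identityʳ s)))

  M-pow : ∀ s → pow G M (p ^ s) ≈ mexp G (αab G p α n s m) x
  M-pow s = trans (mexp-pow G α x (p ^ s))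
    (trans (mexp-congʳ G α (λ i → *-comm (x i) (p ^ s))) (sym (mexp-αab s x)))

  β≈γ∙M : β ≈ γ ∙ M
  β≈γ∙M = sym (//-rightDividesˡ M β)

  β-pow-span : ∀ s → InSpan G (αab G p α n s m) (pow G γ (p ^ s))
    → InSpan G (αab G p α n s m) (pow G β (p ^ s))
  β-pow-span s γ-span = let w , αʷ≈ = InSpan-∙ G γ-span (x , sym (M-pow s)) in
    w , trans αʷ≈ (sym (trans (pow-congˡ G (p ^ s) β≈γ∙M) (pow-∙ G γ M (p ^ s))))

  DL*⇒NotInSpanBelow : ∀ {h} → IsDLStar G p α n 0 m β x h → NotInSpanBelow h
  DL*⇒NotInSpanBelow (inj₁ (_ , below , _)) = below
  DL*⇒NotInSpanBelow (inj₂ (≡.refl , below , _)) = below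

  DL*⇒γ-pow≈ε : ∀ {h} → IsDLStar G p α n 0 m β x h → OrdLe G β (p ^ m) → pow G γ (p ^ h) ≈ ε
  DL*⇒γ-pow≈ε {h} (inj₁ (_ , _ , _ , _ , αabˣ≈βᵖʰ)) _ = ∙-cancelʳ (pow G M (p ^ h)) _ _ (begin
    pow G γ (p ^ h) ∙ pow G M (p ^ h)   ≈⟨ pow-∙ G γ M (p ^ h) ⟨
    pow G (γ ∙ M) (p ^ h)               ≈⟨ pow-congˡ G (p ^ h) β≈γ∙M ⟨
    pow G β (p ^ h)                     ≈⟨ αabˣ≈βᵖʰ ⟨
    mexp G (αab G p α n h m) x          ≈⟨ M-pow h ⟨
    pow G M (p ^ h)                     ≈⟨ identityˡ _ ⟨
    ε ∙ pow G M (p ^ h)                 ∎)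
  DL*⇒γ-pow≈ε (inj₂ (≡.refl , _ , x≡0)) β-ord≤ =
    trans (pow-congˡ G (p ^ m) γ≈β) (OrdLe⇒pow≈ε G 1<p pgroup {k = m} β-ord≤)
    where
    γ≈β : γ ≈ β
    γ≈β = begin
      β ∙ M ⁻¹    ≈⟨ ∙-congˡ (⁻¹-cong (trans (mexp-congʳ G α x≡0) (mexp-zero G α))) ⟩
      β ∙ ε ⁻¹    ≈⟨ ∙-congˡ ε⁻¹≈ε ⟩
      β ∙ ε       ≈⟨ identityʳ β ⟩
      β           ∎

  γ-pow-alive : ∀ {h} → NotInSpanBelow h → ∀ h′ → h′ < h → ¬ pow G γ (p ^ h′) ≈ ε
  γ-pow-alive below h′ h′<h γᵖʰ′≈ε =
    below h′ h′<h (β-pow-span h′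
      ((λ _ → 0) , trans (mexp-zero G (αab G p α n h′ m)) (sym γᵖʰ′≈ε)))

  γ-pow-span-refine : ∀ {h s} → pow G γ (p ^ h) ≈ ε → (∀ i → h ≤ n i) → s ≤ h
    → InSpan G α (pow G γ (p ^ s)) → InSpan G (αab G p α n s m) (pow G γ (p ^ s))
  γ-pow-span-refine {h} {s} γᵖʰ≈ε h≤n s≤h (w , αʷ≈γᵖˢ) = q , (begin
    mexp G (αab G p α n s m) q      ≈⟨ mexp-αab s q ⟩
    mexp G α (λ i → p ^ s * q i)    ≈⟨ mexp-congʳ G α (λ i → ≡.sym (w≡ i)) ⟩
    mexp G α w                      ≈⟨ αʷ≈γᵖˢ ⟩
    pow G γ (p ^ s)                 ∎)
    where
    t = h ∸ s
    αʷᵖᵗ≈ε : pow G (mexp G α w) (p ^ t) ≈ ε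
    αʷᵖᵗ≈ε = begin
      pow G (mexp G α w) (p ^ t)      ≈⟨ pow-congˡ G (p ^ t) αʷ≈γᵖˢ ⟩
      pow G (pow G γ (p ^ s)) (p ^ t) ≈⟨ pow-* G γ (p ^ s) (p ^ t) ⟨
      pow G γ (p ^ s * p ^ t)         ≡⟨ cong (pow G γ) (^-distribˡ-+-* p s t) ⟨
      pow G γ (p ^ (s + t))           ≡⟨ cong (pow G γ ∘ (p ^_)) (m+[n∸m]≡n s≤h) ⟩
      pow G γ (p ^ h)                 ≈⟨ γᵖʰ≈ε ⟩
      ε                               ∎
    pˢ∣w : ∀ i → p ^ s ∣ w i
    pˢ∣w = basis-pow≈ε⇒∣ G {s = s} {t} 1<p basis hα αʷᵖᵗ≈ε
      (λ i → ≤-trans (≤-reflexive (m+[n∸m]≡n s≤h)) (h≤n i))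
    q : Fin r → ℕ
    q i = quotient (pˢ∣w i)
    w≡ : ∀ i → w i ≡ p ^ s * q i
    w≡ i = ≡.trans (_∣_.equality (pˢ∣w i)) (*-comm (q i) (p ^ s))

  γ-pow-outside : ∀ {h} → pow G γ (p ^ h) ≈ ε → NotInSpanBelow h → (∀ i → h ≤ n i)
    → ∀ d → 0 < d → d < p ^ h → ¬ InSpan G α (pow G γ d)
  γ-pow-outside γᵖʰ≈ε below h≤n d 0<d d<pʰ (w , αʷ≈γᵈ) =
    let s , a , s<h , γᵖˢ≈ = p-power∈⟨pow⟩ G pr γᵖʰ≈ε 0<d d<pʰ
        γᵖˢ∈⟨α⟩ = (λ i → w i * a) ,
          trans (sym (mexp-pow G α w a)) (trans (pow-congˡ G a αʷ≈γᵈ) (sym γᵖˢ≈))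
    in below s s<h (β-pow-span s (γ-pow-span-refine γᵖʰ≈ε h≤n (<⇒≤ s<h) γᵖˢ∈⟨α⟩))

lemma4 : ∀ {c ℓ} (G : AbelianGroup c ℓ) (p : ℕ) → Prime p
  → Finite G → IsPGroup G p
  → (r : ℕ) (α : Fin r → AbelianGroup.Carrier G) (n : Fin r → ℕ)
  → (∀ i → HasOrder G (α i) (p ^ n i))
  → IsBasis G α
  → (β : AbelianGroup.Carrier G) (x : Fin r → ℕ) (h : ℕ)
  → IsDLStar G p α n 0 (maxF n) β x h
  → let γ = AbelianGroup._∙_ G β (AbelianGroup._⁻¹ G (mexp G α x)) in
    (OrdLe G β (p ^ maxF n) → HasOrder G γ (p ^ h))
    × (OrdLe G β (p ^ maxF n) → OrdLe G γ (p ^ minF n) → IsBasis G (snoc α γ))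
lemma4 G p pr _ pgroup r α n hα basis β x h dl* = γ-order , γ-independent
  where
  open Residue G pr pgroup {n = n} hα basis β x
  γ-order : OrdLe G β (p ^ maxF n) → HasOrder G γ (p ^ h)
  γ-order β-ord≤ = order-p^ G (prime⇒1<p pr) pgroup
    (DL*⇒γ-pow≈ε dl* β-ord≤) (γ-pow-alive (DL*⇒NotInSpanBelow dl*))
  γ-independent : OrdLe G β (p ^ maxF n) → OrdLe G γ (p ^ minF n) → IsBasis G (snoc α γ)
  γ-independent β-ord≤ γ-ord≤ = snoc-basis G basis (γ-order β-ord≤)
    (γ-pow-outside (DL*⇒γ-pow≈ε dl* β-ord≤) (DL*⇒NotInSpanBelow dl*) h≤n)
    where
    h≤n : ∀ i → h ≤ n i
    h≤n i = ≤-trans (OrdLe-p^⇒≤ G (prime⇒1<p pr) {e = h} {minF n} (γ-order β-ord≤) γ-ord≤)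
                    (minF-lower n i)
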